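{- Let $k\ge1$ and let $F_n^K(\mathbf z;q)=\sum_{\pi\in PRLP_n^K}\big(\prod_j z_{\ell_j}\big)q^{\mathrm{inv}(\pi)}$ as in the context. Then for all $m,n\ge1$, $$F_{m+n}^k(\mathbf z;q)=q^{nm}F_m^k(\mathbf z;q)F_n^k(\mathbf z;q)+\sum_{i=2}^k\sum_{j=1}^{i-1}z_i\,q^{\binom{i-1}{2}+i(n-i+j)}q^{(m-j)(n+j)}F_{m-j}^k(\mathbf z;q)F_{n-i+j}^k(\mathbf z;q),$$ and for all $n\ge1$, $$F_n^k(\mathbf z;q)=F_n^{k-1}(\mathbf z;q)+\sum_{j=0}^{n-k}z_k\,q^{\binom{k-1}{2}+k(n-k-j)}q^{j(n-j)}F_j^{k-1}(\mathbf z;q)F_{n-k-j}^k(\mathbf z;q).$$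
   Context: For a composition $(\ell_1,\dots,\ell_r)$ of $n$, the layered permutation of $[n]$ has first $\ell_1$ entries the $\ell_1$ largest elements of $[n]$ in increasing order, next $\ell_2$ entries the next largest $\ell_2$ elements in increasing order, etc. The associated partially reversed layered permutation reverses the first $\ell_j-1$ entries of each layer (a layer with values $a,\dots,a+\ell-1$ becomes $a+\ell-2,\dots,a,a+\ell-1$); its layer lengths are $\ell_1,\dots,\ell_r$. For $K\ge0$, $PRLP_n^K$ is the set of such permutations of $[n]$ with all layers of length at most $K$. $\mathbf z=(z_1,\dots,z_k)$ are indeterminates; $\mathrm{inv}$ is the inversion number. Conventions: $F_0^K=1$, $F_n^K=0$ for $n<0$. -}

module Defs where

open import Level using (Level)
open import Data.Bool using (Bool; true; false; if_then_else_; _∧_)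
open import Data.Nat using (ℕ; zero; suc; _∸_; _≤ᵇ_; _<ᵇ_) renaming (_+_ to _+ℕ_)
open import Data.List using (List; []; _∷_; _++_; [_]; map; concatMap; applyUpTo; reverse; foldr; filterᵇ; length)
open import Data.Nat.ListAction using (sum)
open import Algebra.Bundles using (CommutativeRing)

-- Compositions of n with all parts in {1,…,K}.
-- compsF K fuel n : fuel-bounded enumeration; fuel n suffices since
-- every part is ≥ 1.  A composition (ℓ₁,…,ℓᵣ) is the list ℓ₁ ∷ … ∷ ℓᵣ ∷ [].

compsF : (K fuel n : ℕ) → List (List ℕ)
compsF K fuel    zero    = [ [] ]
compsF K zero    (suc n) = []
compsF K (suc f) (suc n) =
  concatMap (λ ℓ → map (ℓ ∷_) (compsF K f (suc n ∸ ℓ)))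
            (filterᵇ (λ ℓ → ℓ ≤ᵇ suc n) (applyUpTo suc K))

comps : (K n : ℕ) → List (List ℕ)
comps K n = compsF K n n

-- Partially reversed layered permutation (as the list π(1),…,π(n)).
-- A layer with values a,…,a+ℓ-1 becomes a+ℓ-2,…,a,a+ℓ-1.

layer : (a ℓ : ℕ) → List ℕ
layer a zero    = []
layer a (suc l) = reverse (applyUpTo (a +ℕ_) l) ++ [ a +ℕ l ]

-- the first layer uses the ℓ₁ largest values, i.e. it starts at
-- (sum of the remaining layers) + 1
prlp : List ℕ → List ℕ
prlp []       = []
prlp (ℓ ∷ ls) = layer (suc (sum ls)) ℓ ++ prlp ls

inv : List ℕ → ℕ
inv []       = 0
inv (x ∷ xs) = length (filterᵇ (λ y → y <ᵇ x) xs) +ℕ inv xs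

-- Evaluation of the generating function in an arbitrary commutative ring
-- (the indeterminates z₁,…,z_k and q are specialised to arbitrary
-- ring elements; an identity valid for all such evaluations in all
-- commutative rings is exactly a polynomial identity).

module Gen {c ℓ : Level} (R : CommutativeRing c ℓ) where
  open CommutativeRing R public

  pow : Carrier → ℕ → Carrier
  pow x zero    = 1#
  pow x (suc n) = x * pow x n

  -- Σ_{i=a}^{b} f i  (empty if b < a)
  sumFromTo : ℕ → ℕ → (ℕ → Carrier) → Carrier
  sumFromTo a b f = foldr _+_ 0# (map f (applyUpTo (a +ℕ_) (suc b ∸ a)))

  prodList : List Carrier → Carrier
  prodList = foldr _*_ 1#

  weight : (ℕ → Carrier) → Carrier → List ℕ → Carrier
  weight z q ls = prodList (map z ls) * pow q (inv (prlp ls))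

  F : (K : ℕ) → (ℕ → Carrier) → Carrier → ℕ → Carrier
  F K z q n = foldr _+_ 0# (map (weight z q) (comps K n))

module Submission where

-- Everything rests on the first-layer recursion F-rec: a PRLP whose first layer
-- has length l is that layer, whose values lie above the n - l others, followed
-- by any PRLP of size n - l, so
--   F K n = Σ_{1 ≤ l ≤ min(K, n)} z_l q^((l-1) C 2 + l (n - l)) F K (n - l)   (n ≥ 1).
-- Both identities of the theorem follow from this recursion alone, and for all
-- m, n ≥ 0: the splitting identity (Splitting) by strong induction on m, the
-- maximal-layer identity (MaximalLayer) by strong induction on n.  Each step
-- expands the first layer, applies the induction hypothesis to the rest and
-- regroups the double sums (FiniteSums); the powers of q always match by one
-- exponent identity, layerWeight-shift.

open import Defs
open import Level using (Level)
open import Data.Bool using (Bool; true; false; T; if_then_else_; _∧_)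
open import Data.Bool.Properties using (T?)
open import Data.Nat using (ℕ; zero; suc; NonZero; _≤_; _<_; _≤ᵇ_; _<ᵇ_; _≡ᵇ_; _∸_; z≤n; s≤s; s≤s⁻¹; z<s; s<s)
  renaming (_+_ to _+ℕ_; _*_ to _*ℕ_)
import Data.Nat.Properties as ℕₚ
open import Data.Nat.Combinatorics using (_C_; nC1≡n; nCk+nC[k+1]≡[n+1]C[k+1])
open import Data.Nat.ListAction using (sum)
open import Data.Nat.Tactic.RingSolver using (solve-∀)
open import Data.List using (List; []; _∷_; _++_; [_]; map; concat; concatMap; applyUpTo; applyDownFrom; foldr; filterᵇ; length)
open import Data.List.Properties using (length-++; map-++; map-∘; length-applyDownFrom; reverse-applyUpTo; filter-++; filter-all; filter-none; map-cong-local)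
open import Data.List.Relation.Unary.All as All using (All; []; _∷_)
open import Data.List.Relation.Unary.All.Properties using (++⁺; map⁺; concat⁺; applyDownFrom⁺₁; applyUpTo⁺₂; all-filter; filter⁺)
open import Data.Product using (_×_; _,_)
open import Function using (_∘_)
open import Relation.Binary.PropositionalEquality as ≡ using (_≡_; _≢_)
open import Relation.Nullary using (contradiction; yes; no; ofʸ; ofⁿ)
open import Algebra.Bundles using (CommutativeRing)

module Guards where
  open ≡
  open ℕₚ

  ≤ᵇ-true : ∀ {m n} → m ≤ n → (m ≤ᵇ n) ≡ true
  ≤ᵇ-true {m} {n} m≤n with m ≤ᵇ n | ≤ᵇ-reflects-≤ m n
  ... | true  | _       = refl
  ... | false | ofⁿ m≰n = contradiction m≤n m≰n

  ≤ᵇ-false : ∀ {m n} → n < m → (m ≤ᵇ n) ≡ false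
  ≤ᵇ-false {m} {n} n<m with m ≤ᵇ n | ≤ᵇ-reflects-≤ m n
  ... | true  | ofʸ m≤n = contradiction m≤n (<⇒≱ n<m)
  ... | false | _       = refl

  module _ {a} {A : Set a} {x y : A} where

    if-≤ᵇ-yes : ∀ {m n} → m ≤ n → (if m ≤ᵇ n then x else y) ≡ x
    if-≤ᵇ-yes m≤n = cong (if_then x else y) (≤ᵇ-true m≤n)

    if-≤ᵇ-no : ∀ {m n} → n < m → (if m ≤ᵇ n then x else y) ≡ y
    if-≤ᵇ-no n<m = cong (if_then x else y) (≤ᵇ-false n<m)

    if-≡ᵇ-yes : ∀ {m n} → m ≡ n → (if m ≡ᵇ n then x else y) ≡ x
    if-≡ᵇ-yes {m} {n} m≡n with m ≡ᵇ n in eq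
    ... | true  = refl
    ... | false = contradiction (≡⇒≡ᵇ m n m≡n) (subst T eq)

    if-≡ᵇ-no : ∀ {m n} → m ≢ n → (if m ≡ᵇ n then x else y) ≡ y
    if-≡ᵇ-no {m} {n} m≢n with m ≡ᵇ n in eq
    ... | true  = contradiction (≡ᵇ⇒≡ m n (subst T (sym eq) _)) m≢n
    ... | false = refl

module Inversions where
  open ≡ hiding ([_])
  open ℕₚ

  -- cross xs ys counts the pairs (x , y) with x in xs, y in ys and y < x:
  -- the inversions between a block xs and a block ys written after it.
  cross : List ℕ → List ℕ → ℕ
  cross []       ys = 0
  cross (x ∷ xs) ys = length (filterᵇ (_<ᵇ x) ys) +ℕ cross xs ys

  inv-++ : ∀ xs ys → inv (xs ++ ys) ≡ inv xs +ℕ cross xs ys +ℕ inv ys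
  inv-++ []       ys = refl
  inv-++ (x ∷ xs) ys = begin
    length (filterᵇ (_<ᵇ x) (xs ++ ys)) +ℕ inv (xs ++ ys)
      ≡⟨ cong₂ _+ℕ_ (trans (cong length (filter-++ (T? ∘ (_<ᵇ x)) xs ys)) (length-++ (filterᵇ (_<ᵇ x) xs)))
                    (inv-++ xs ys) ⟩
    (a +ℕ b) +ℕ (inv xs +ℕ cross xs ys +ℕ inv ys)
      ≡⟨ regroup a b (inv xs) (cross xs ys) (inv ys) ⟩
    a +ℕ inv xs +ℕ (b +ℕ cross xs ys) +ℕ inv ys ∎
    where
    open ≡-Reasoning
    a : ℕ
    a = length (filterᵇ (_<ᵇ x) xs)
    b : ℕ
    b = length (filterᵇ (_<ᵇ x) ys)
    regroup : ∀ a b c d e → (a +ℕ b) +ℕ (c +ℕ d +ℕ e) ≡ a +ℕ c +ℕ (b +ℕ d) +ℕ e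
    regroup = solve-∀

  cross-below : ∀ {b} xs ys → All (b ≤_) xs → All (_< b) ys → cross xs ys ≡ length xs *ℕ length ys
  cross-below []       ys []           _    = refl
  cross-below (x ∷ xs) ys (b≤x ∷ b≤xs) ys<b = cong₂ _+ℕ_
    (cong length (filter-all (T? ∘ (_<ᵇ x)) (All.map (λ y<b → <⇒<ᵇ (<-≤-trans y<b b≤x)) ys<b)))
    (cross-below xs ys b≤xs ys<b)

  cross-above : ∀ {b} xs ys → All (_≤ b) xs → All (b ≤_) ys → cross xs ys ≡ 0
  cross-above []       ys []           _    = refl
  cross-above (x ∷ xs) ys (x≤b ∷ xs≤b) b≤ys = cong₂ _+ℕ_
    (cong length (filter-none (T? ∘ (_<ᵇ x))
      (All.map (λ b≤y y<x → <⇒≱ (<ᵇ⇒< _ x y<x) (≤-trans x≤b b≤y)) b≤ys)))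
    (cross-above xs ys xs≤b b≤ys)

  inv-decreasing : ∀ a l → inv (applyDownFrom (a +ℕ_) l) ≡ l C 2
  inv-decreasing a zero    = refl
  inv-decreasing a (suc l) = begin
    length (filterᵇ (_<ᵇ a +ℕ l) run) +ℕ inv run
      ≡⟨ cong₂ _+ℕ_ (trans (cong length (filter-all (T? ∘ (_<ᵇ a +ℕ l)) below)) (length-applyDownFrom (a +ℕ_) l))
                    (inv-decreasing a l) ⟩
    l +ℕ l C 2     ≡⟨ cong (_+ℕ l C 2) (nC1≡n l) ⟨
    l C 1 +ℕ l C 2 ≡⟨ nCk+nC[k+1]≡[n+1]C[k+1] l 1 ⟩
    suc l C 2      ∎
    where
    open ≡-Reasoning
    run : List ℕ
    run = applyDownFrom (a +ℕ_) l
    below : All (λ y → T (y <ᵇ a +ℕ l)) run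
    below = applyDownFrom⁺₁ (a +ℕ_) l (λ i<l → <⇒<ᵇ (+-monoʳ-< a i<l))

  layer-suc : ∀ a l → layer a (suc l) ≡ applyDownFrom (a +ℕ_) l ++ [ a +ℕ l ]
  layer-suc a l = cong (_++ [ a +ℕ l ]) (reverse-applyUpTo (a +ℕ_) l)

  layer⁺ : ∀ {p} {P : ℕ → Set p} a l → (∀ {i} → i < l → P (a +ℕ i)) → All P (layer a l)
  layer⁺ a zero    _  = []
  layer⁺ a (suc l) Pa = subst (All _) (sym (layer-suc a l))
    (++⁺ (applyDownFrom⁺₁ (a +ℕ_) l (Pa ∘ m<n⇒m<1+n)) (Pa (n<1+n l) ∷ []))

  length-layer : ∀ a l → length (layer a l) ≡ l
  length-layer a zero    = refl
  length-layer a (suc l) = begin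
    length (layer a (suc l))                       ≡⟨ cong length (layer-suc a l) ⟩
    length (applyDownFrom (a +ℕ_) l ++ [ a +ℕ l ]) ≡⟨ length-++ (applyDownFrom (a +ℕ_) l) ⟩
    length (applyDownFrom (a +ℕ_) l) +ℕ 1          ≡⟨ cong (_+ℕ 1) (length-applyDownFrom (a +ℕ_) l) ⟩
    l +ℕ 1                                         ≡⟨ +-comm l 1 ⟩
    suc l                                          ∎
    where open ≡-Reasoning

  -- A layer of length l has (l-1) C 2 inversions: those of its decreasing run.
  inv-layer : ∀ a l → inv (layer a l) ≡ (l ∸ 1) C 2
  inv-layer a zero    = refl
  inv-layer a (suc l) = begin
    inv (layer a (suc l))                      ≡⟨ cong inv (layer-suc a l) ⟩
    inv (run ++ [ a +ℕ l ])                    ≡⟨ inv-++ run [ a +ℕ l ] ⟩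
    inv run +ℕ cross run [ a +ℕ l ] +ℕ 0       ≡⟨ cong₂ (λ u v → u +ℕ v +ℕ 0) (inv-decreasing a l) top-last ⟩
    l C 2 +ℕ 0 +ℕ 0                            ≡⟨ trans (+-identityʳ _) (+-identityʳ _) ⟩
    l C 2                                      ∎
    where
    open ≡-Reasoning
    run : List ℕ
    run = applyDownFrom (a +ℕ_) l
    top-last : cross run [ a +ℕ l ] ≡ 0
    top-last = cross-above run _ (applyDownFrom⁺₁ (a +ℕ_) l (λ i<l → +-monoʳ-≤ a (<⇒≤ i<l))) (≤-refl ∷ [])

  prlp-below : ∀ c → All (_< suc (sum c)) (prlp c)
  prlp-below []      = []
  prlp-below (l ∷ c) = ++⁺
    (layer⁺ (suc (sum c)) l (λ {i} i<l → s≤s (subst (sum c +ℕ i <_) (+-comm (sum c) l) (+-monoʳ-< (sum c) i<l))))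
    (All.map (λ x<c → ≤-trans x<c (s≤s (m≤n+m (sum c) l))) (prlp-below c))

  length-prlp : ∀ c → length (prlp c) ≡ sum c
  length-prlp []      = refl
  length-prlp (l ∷ c) = trans (length-++ (layer (suc (sum c)) l)) (cong₂ _+ℕ_ (length-layer _ l) (length-prlp c))

  -- Peeling off the first layer: its own inversions, plus one inversion with
  -- each of the sum c smaller values that follow it.
  inv-prlp-cons : ∀ l c → inv (prlp (l ∷ c)) ≡ ((l ∸ 1) C 2 +ℕ l *ℕ sum c) +ℕ inv (prlp c)
  inv-prlp-cons l c = begin
    inv (first ++ prlp c)                                      ≡⟨ inv-++ first (prlp c) ⟩
    inv first +ℕ cross first (prlp c) +ℕ inv (prlp c)          ≡⟨ cong (λ t → inv first +ℕ t +ℕ inv (prlp c)) first-above-rest ⟩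
    inv first +ℕ length first *ℕ length (prlp c) +ℕ inv (prlp c)
      ≡⟨ cong₂ (λ u v → u +ℕ v +ℕ inv (prlp c)) (inv-layer _ l) (cong₂ _*ℕ_ (length-layer _ l) (length-prlp c)) ⟩
    (l ∸ 1) C 2 +ℕ l *ℕ sum c +ℕ inv (prlp c)                  ∎
    where
    open ≡-Reasoning
    first : List ℕ
    first = layer (suc (sum c)) l
    first-above-rest : cross first (prlp c) ≡ length first *ℕ length (prlp c)
    first-above-rest = cross-below first (prlp c) (layer⁺ (suc (sum c)) l (λ {i} _ → m≤m+n (suc (sum c)) i)) (prlp-below c)

module Compositions where
  open ≡ hiding ([_])
  open ℕₚ

  firstLengths : ℕ → ℕ → List ℕ
  firstLengths K n = filterᵇ (_≤ᵇ n) (applyUpTo suc K)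

  firstLengths-positive : ∀ K n → All (1 ≤_) (firstLengths K n)
  firstLengths-positive K n = filter⁺ (T? ∘ (_≤ᵇ n)) (applyUpTo⁺₂ suc K (λ _ → s≤s z≤n))

  firstLengths-bounded : ∀ K n → All (_≤ n) (firstLengths K n)
  firstLengths-bounded K n = All.map (≤ᵇ⇒≤ _ n) (all-filter (T? ∘ (_≤ᵇ n)) (applyUpTo suc K))

  compsF-fuel : ∀ K {f g} n → n ≤ f → n ≤ g → compsF K f n ≡ compsF K g n
  compsF-fuel K zero _ _ = refl
  compsF-fuel K {suc f} {suc g} (suc n) (s≤s n≤f) (s≤s n≤g) =
    cong concat (map-cong-local (All.map same-tails (firstLengths-positive K (suc n))))
    where
    same-tails : ∀ {l} → 1 ≤ l → map (l ∷_) (compsF K f (suc n ∸ l)) ≡ map (l ∷_) (compsF K g (suc n ∸ l))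
    same-tails {suc l} _ = cong (map (suc l ∷_)) (compsF-fuel K (n ∸ l) (≤-trans (m∸n≤m n l) n≤f) (≤-trans (m∸n≤m n l) n≤g))

  compsF-sum : ∀ K f n → All (λ c → sum c ≡ n) (compsF K f n)
  compsF-sum K f       zero    = refl ∷ []
  compsF-sum K zero    (suc n) = []
  compsF-sum K (suc f) (suc n) = concat⁺ (map⁺ (All.map tails-sum (firstLengths-bounded K (suc n))))
    where
    tails-sum : ∀ {l} → l ≤ suc n → All (λ c → sum c ≡ suc n) (map (l ∷_) (compsF K f (suc n ∸ l)))
    tails-sum {l} l≤n = map⁺ (All.map (λ sum≡ → trans (cong (l +ℕ_) sum≡) (m+[n∸m]≡n l≤n)) (compsF-sum K f (suc n ∸ l)))

module Exponents where
  open ≡ hiding ([_])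
  open ℕₚ

  ∸-swap : ∀ a b c → a ∸ b ∸ c ≡ a ∸ c ∸ b
  ∸-swap a b c = begin
    a ∸ b ∸ c    ≡⟨ ∸-+-assoc a b c ⟩
    a ∸ (b +ℕ c) ≡⟨ cong (a ∸_) (+-comm b c) ⟩
    a ∸ (c +ℕ b) ≡⟨ ∸-+-assoc a c b ⟨
    a ∸ c ∸ b    ∎
    where open ≡-Reasoning

  -- Sizes around a cut after position m that falls j entries into a layer.
  cut-sizes : ∀ {j m} n → j ≤ m → (m ∸ j) +ℕ (n +ℕ j) ≡ m +ℕ n
  cut-sizes {j} {m} n j≤m = begin
    (m ∸ j) +ℕ (n +ℕ j) ≡⟨ cong ((m ∸ j) +ℕ_) (+-comm n j) ⟩
    (m ∸ j) +ℕ (j +ℕ n) ≡⟨ +-assoc (m ∸ j) j n ⟨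
    (m ∸ j) +ℕ j +ℕ n   ≡⟨ cong (_+ℕ n) (m∸n+n≡m j≤m) ⟩
    m +ℕ n              ∎
    where open ≡-Reasoning

  ∸-pred : ∀ {x n} → x < n → n ∸ x ≡ suc (n ∸ suc x)
  ∸-pred {zero}  {suc n} _         = refl
  ∸-pred {suc x} {suc n} (s≤s x<n) = ∸-pred x<n

  -- Removing a first layer of length x + 1 and then y - x further entries.
  ∸-in-two-steps : ∀ {x y} n → x ≤ y → n ∸ suc x ∸ (y ∸ x) ≡ n ∸ suc y
  ∸-in-two-steps {x} {y} n x≤y = trans (∸-+-assoc n (suc x) (y ∸ x)) (cong (λ t → n ∸ suc t) (m+[n∸m]≡n x≤y))

  -- Exponent bookkeeping for a first layer of length l in a block of size M:
  -- appending d smaller values gives it l·d more inversions, and moves the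
  -- (M - l)·d inversions of the rest of the block into the total M·d.
  layer-shift-exponent : ∀ e l M d → l ≤ M →
    (e +ℕ l *ℕ (M +ℕ d ∸ l)) +ℕ (M ∸ l) *ℕ d ≡ M *ℕ d +ℕ (e +ℕ l *ℕ (M ∸ l))
  layer-shift-exponent e l M d l≤M = begin
    (e +ℕ l *ℕ (M +ℕ d ∸ l)) +ℕ r *ℕ d ≡⟨ cong (λ t → (e +ℕ l *ℕ t) +ℕ r *ℕ d) (+-∸-comm d l≤M) ⟩
    (e +ℕ l *ℕ (r +ℕ d)) +ℕ r *ℕ d     ≡⟨ expand e l r d ⟩
    (l +ℕ r) *ℕ d +ℕ (e +ℕ l *ℕ r)     ≡⟨ cong (λ t → t *ℕ d +ℕ (e +ℕ l *ℕ r)) (m+[n∸m]≡n l≤M) ⟩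
    M *ℕ d +ℕ (e +ℕ l *ℕ r)            ∎
    where
    open ≡-Reasoning
    r : ℕ
    r = M ∸ l
    expand : ∀ e l r d → (e +ℕ l *ℕ (r +ℕ d)) +ℕ r *ℕ d ≡ (l +ℕ r) *ℕ d +ℕ (e +ℕ l *ℕ r)
    expand = solve-∀

open Guards
open Inversions
open Compositions
open Exponents

module FiniteSums {c ℓ} (R : CommutativeRing c ℓ) where
  open CommutativeRing R hiding (zero)
  open import Relation.Binary.Reasoning.Setoid setoid

  lsum : List Carrier → Carrier
  lsum = foldr _+_ 0#

  lsum-++ : ∀ xs ys → lsum (xs ++ ys) ≈ lsum xs + lsum ys
  lsum-++ []       ys = sym (+-identityˡ _)
  lsum-++ (x ∷ xs) ys = trans (+-congˡ (lsum-++ xs ys)) (sym (+-assoc _ _ _))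

  lsum-concatMap : ∀ {a b} {A : Set a} {B : Set b} (g : B → Carrier) (h : A → List B) xs →
    lsum (map g (concatMap h xs)) ≈ lsum (map (λ x → lsum (map g (h x))) xs)
  lsum-concatMap g h []       = refl
  lsum-concatMap g h (x ∷ xs) = begin
    lsum (map g (h x ++ concatMap h xs))               ≡⟨ ≡.cong lsum (map-++ g (h x) (concatMap h xs)) ⟩
    lsum (map g (h x) ++ map g (concatMap h xs))       ≈⟨ lsum-++ (map g (h x)) _ ⟩
    lsum (map g (h x)) + lsum (map g (concatMap h xs)) ≈⟨ +-congˡ (lsum-concatMap g h xs) ⟩
    lsum (map g (h x)) + lsum (map (λ x → lsum (map g (h x))) xs) ∎

  lsum-filter : ∀ {a} {A : Set a} (g : A → Carrier) (p : A → Bool) xs →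
    lsum (map g (filterᵇ p xs)) ≈ lsum (map (λ x → if p x then g x else 0#) xs)
  lsum-filter g p []       = refl
  lsum-filter g p (x ∷ xs) with p x
  ... | true  = +-congˡ (lsum-filter g p xs)
  ... | false = trans (lsum-filter g p xs) (sym (+-identityˡ _))

  lsum-congᴬ : ∀ {a p} {A : Set a} {P : A → Set p} {g h : A → Carrier} {xs} →
    All P xs → (∀ {x} → P x → g x ≈ h x) → lsum (map g xs) ≈ lsum (map h xs)
  lsum-congᴬ []         _   = refl
  lsum-congᴬ (px ∷ pxs) g≈h = +-cong (g≈h px) (lsum-congᴬ pxs g≈h)

  lsum-*ˡ : ∀ {a} {A : Set a} (x : Carrier) (g : A → Carrier) xs → lsum (map (λ y → x * g y) xs) ≈ x * lsum (map g xs)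
  lsum-*ˡ x g []       = sym (zeroʳ x)
  lsum-*ˡ x g (y ∷ ys) = trans (+-congˡ (lsum-*ˡ x g ys)) (sym (distribˡ x _ _))

  Σ< : ℕ → (ℕ → Carrier) → Carrier
  Σ< zero    f = 0#
  Σ< (suc N) f = f 0 + Σ< N (f ∘ suc)

  lsum-applyUpTo : ∀ (f : ℕ → Carrier) h N → lsum (map f (applyUpTo h N)) ≡ Σ< N (f ∘ h)
  lsum-applyUpTo f h zero    = ≡.refl
  lsum-applyUpTo f h (suc N) = ≡.cong (f (h 0) +_) (lsum-applyUpTo f (h ∘ suc) N)

  Σ-congᴮ : ∀ N {f g : ℕ → Carrier} → (∀ {x} → x < N → f x ≈ g x) → Σ< N f ≈ Σ< N g
  Σ-congᴮ zero    _   = refl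
  Σ-congᴮ (suc N) f≈g = +-cong (f≈g z<s) (Σ-congᴮ N (f≈g ∘ s<s))

  Σ-cong : ∀ N {f g : ℕ → Carrier} → (∀ x → f x ≈ g x) → Σ< N f ≈ Σ< N g
  Σ-cong N f≈g = Σ-congᴮ N (λ {x} _ → f≈g x)

  Σ-zero : ∀ N {f : ℕ → Carrier} → (∀ {x} → x < N → f x ≈ 0#) → Σ< N f ≈ 0#
  Σ-zero zero    _   = refl
  Σ-zero (suc N) f≈0 = trans (+-cong (f≈0 z<s) (Σ-zero N (f≈0 ∘ s<s))) (+-identityˡ 0#)

  Σ-+ : ∀ N (f g : ℕ → Carrier) → Σ< N (λ x → f x + g x) ≈ Σ< N f + Σ< N g
  Σ-+ zero    f g = sym (+-identityˡ 0#)
  Σ-+ (suc N) f g = trans (+-congˡ (Σ-+ N (f ∘ suc) (g ∘ suc))) (+-interchange (f 0) (g 0) _ _)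
    where open import Algebra.Properties.CommutativeSemigroup +-commutativeSemigroup using () renaming (interchange to +-interchange)

  Σ-*ˡ : ∀ N (a : Carrier) (f : ℕ → Carrier) → Σ< N (λ x → a * f x) ≈ a * Σ< N f
  Σ-*ˡ zero    a f = sym (zeroʳ a)
  Σ-*ˡ (suc N) a f = trans (+-congˡ (Σ-*ˡ N a (f ∘ suc))) (sym (distribˡ a _ _))

  Σ-*ʳ : ∀ N (a : Carrier) (f : ℕ → Carrier) → Σ< N (λ x → f x * a) ≈ Σ< N f * a
  Σ-*ʳ N a f = begin
    Σ< N (λ x → f x * a) ≈⟨ Σ-cong N (λ x → *-comm (f x) a) ⟩
    Σ< N (λ x → a * f x) ≈⟨ Σ-*ˡ N a f ⟩
    a * Σ< N f           ≈⟨ *-comm a _ ⟩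
    Σ< N f * a           ∎

  Σ-swap : ∀ N M (g : ℕ → ℕ → Carrier) → Σ< N (λ x → Σ< M (g x)) ≈ Σ< M (λ y → Σ< N (λ x → g x y))
  Σ-swap zero    M g = sym (Σ-zero M (λ _ → refl))
  Σ-swap (suc N) M g = begin
    Σ< M (g 0) + Σ< N (λ x → Σ< M (g (suc x)))      ≈⟨ +-congˡ (Σ-swap N M (g ∘ suc)) ⟩
    Σ< M (g 0) + Σ< M (λ y → Σ< N (λ x → g (suc x) y)) ≈⟨ Σ-+ M (g 0) _ ⟨
    Σ< M (λ y → Σ< (suc N) (λ x → g x y))           ∎

  Σ-last : ∀ N (f : ℕ → Carrier) → Σ< (suc N) f ≈ Σ< N f + f N
  Σ-last zero    f = +-comm (f 0) 0#
  Σ-last (suc N) f = trans (+-congˡ (Σ-last N (f ∘ suc))) (sym (+-assoc _ _ _))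

  Σ-prefix : ∀ {a N} {f : ℕ → Carrier} → a ≤ N → (∀ {x} → a ≤ x → x < N → f x ≈ 0#) → Σ< N f ≈ Σ< a f
  Σ-prefix {N = N} z≤n       f≈0 = Σ-zero N (f≈0 z≤n)
  Σ-prefix         (s≤s a≤N) f≈0 = +-congˡ (Σ-prefix a≤N (λ a≤x x<N → f≈0 (s≤s a≤x) (s≤s x<N)))

  Σ-shift : ∀ s M (G : ℕ → Carrier) → Σ< M (λ y → if s ≤ᵇ y then G y else 0#) ≈ Σ< (M ∸ s) (λ j → G (s +ℕ j))
  Σ-shift zero    M       G = refl
  Σ-shift (suc s) zero    G = refl
  Σ-shift (suc s) (suc M) G = begin
    0# + Σ< M (λ y → if suc s ≤ᵇ suc y then G (suc y) else 0#) ≈⟨ +-identityˡ _ ⟩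
    Σ< M (λ y → if suc s ≤ᵇ suc y then G (suc y) else 0#)      ≈⟨ Σ-cong M (λ y → reflexive (≡.cong (λ b → if b then G (suc y) else 0#) (≤ᵇ-suc s y))) ⟩
    Σ< M (λ y → if s ≤ᵇ y then G (suc y) else 0#)              ≈⟨ Σ-shift s M (G ∘ suc) ⟩
    Σ< (M ∸ s) (λ j → G (suc s +ℕ j))                          ∎
    where
    ≤ᵇ-suc : ∀ s y → (suc s ≤ᵇ suc y) ≡ (s ≤ᵇ y)
    ≤ᵇ-suc zero    y = ≡.refl
    ≤ᵇ-suc (suc s) y = ≡.refl

  Σ-delta : ∀ N a (g : Carrier) → Σ< N (λ y → if y ≡ᵇ a then g else 0#) ≈ (if a <ᵇ N then g else 0#)
  Σ-delta zero    a       g = refl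
  Σ-delta (suc N) zero    g = trans (+-congˡ (Σ-zero N (λ _ → refl))) (+-identityʳ g)
  Σ-delta (suc N) (suc a) g = trans (+-identityˡ _) (Σ-delta N a g)

  if-cong : ∀ b {x y} → (T b → x ≈ y) → (if b then x else 0#) ≈ (if b then y else 0#)
  if-cong true  x≈y = x≈y _
  if-cong false _   = refl

module FirstLayer {c ℓ} (R : CommutativeRing c ℓ) (z : ℕ → CommutativeRing.Carrier R) (q : CommutativeRing.Carrier R) where
  open Gen R hiding (zero)
  open FiniteSums R
  open import Relation.Binary.Reasoning.Setoid setoid
  open import Algebra.Properties.CommutativeSemigroup *-commutativeSemigroup using (interchange)

  pow-+ : ∀ a b → pow q (a +ℕ b) ≈ pow q a * pow q b
  pow-+ zero    b = sym (*-identityˡ _)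
  pow-+ (suc a) b = trans (*-congˡ (pow-+ a b)) (sym (*-assoc _ _ _))

  pow-≡ : ∀ {a b} → a ≡ b → pow q a ≈ pow q b
  pow-≡ = reflexive ∘ ≡.cong (pow q)

  bring-forward : ∀ a b c d → a * b * (c * d) ≈ c * a * b * d
  bring-forward a b c d = begin
    a * b * (c * d)   ≈⟨ *-assoc (a * b) c d ⟨
    a * b * c * d     ≈⟨ *-congʳ (*-comm (a * b) c) ⟩
    c * (a * b) * d   ≈⟨ *-congʳ (*-assoc c a b) ⟨
    c * a * b * d     ∎

  -- z_l q^((l-1) C 2 + l (N - l)): the first layer of length l of a PRLP of
  -- size N, with its inner inversions and those with the N - l later values.
  layerWeight : ℕ → ℕ → Carrier
  layerWeight l N = z l * pow q ((l ∸ 1) C 2 +ℕ l *ℕ (N ∸ l))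

  -- The total weight of the PRLPs of size N (parts ≤ K) with first layer of length l.
  firstLayer : ℕ → ℕ → ℕ → Carrier
  firstLayer K N l = if l ≤ᵇ N then layerWeight l N * F K z q (N ∸ l) else 0#

  firstLayer-fits : ∀ {K N l} → l ≤ N → firstLayer K N l ≈ layerWeight l N * F K z q (N ∸ l)
  firstLayer-fits l≤N = reflexive (if-≤ᵇ-yes l≤N)

  firstLayer-too-long : ∀ {K N l} → N < l → firstLayer K N l ≈ 0#
  firstLayer-too-long N<l = reflexive (if-≤ᵇ-no N<l)

  weight-cons : ∀ l cs → weight z q (l ∷ cs) ≈ layerWeight l (l +ℕ sum cs) * weight z q cs
  weight-cons l cs = begin
    (z l * prodList (map z cs)) * pow q (inv (prlp (l ∷ cs)))
      ≈⟨ *-congˡ (trans (pow-≡ (inv-prlp-cons l cs)) (pow-+ e (inv (prlp cs)))) ⟩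
    (z l * prodList (map z cs)) * (pow q e * pow q (inv (prlp cs)))
      ≈⟨ interchange (z l) _ _ _ ⟩
    (z l * pow q e) * weight z q cs
      ≈⟨ *-congʳ (*-congˡ (pow-≡ (≡.cong (λ t → (l ∸ 1) C 2 +ℕ l *ℕ t) (≡.sym (ℕₚ.m+n∸m≡n l (sum cs)))))) ⟩
    layerWeight l (l +ℕ sum cs) * weight z q cs ∎
    where
    e : ℕ
    e = (l ∸ 1) C 2 +ℕ l *ℕ sum cs

  F-zero : ∀ K → F K z q 0 ≈ 1#
  F-zero K = trans (+-identityʳ (1# * 1#)) (*-identityˡ 1#)

  F-rec : ∀ K N → 1 ≤ N → F K z q N ≈ Σ< K (λ x → firstLayer K N (suc x))
  F-rec K (suc N) _ = begin
    lsum (map (weight z q) (concatMap tails (firstLengths K (suc N))))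
      ≈⟨ lsum-concatMap (weight z q) tails (firstLengths K (suc N)) ⟩
    lsum (map (λ l → lsum (map (weight z q) (tails l))) (firstLengths K (suc N)))
      ≈⟨ lsum-filter (λ l → lsum (map (weight z q) (tails l))) (_≤ᵇ suc N) (applyUpTo suc K) ⟩
    lsum (map (λ l → if l ≤ᵇ suc N then lsum (map (weight z q) (tails l)) else 0#) (applyUpTo suc K))
      ≡⟨ lsum-applyUpTo _ suc K ⟩
    Σ< K (λ x → if suc x ≤ᵇ suc N then lsum (map (weight z q) (tails (suc x))) else 0#)
      ≈⟨ Σ-cong K (λ x → if-cong (suc x ≤ᵇ suc N) (λ x<N → tails-total (s≤s⁻¹ (ℕₚ.≤ᵇ⇒≤ _ _ x<N)))) ⟩
    Σ< K (λ x → firstLayer K (suc N) (suc x)) ∎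
    where
    tails : ℕ → List (List ℕ)
    tails l = map (l ∷_) (compsF K N (suc N ∸ l))
    tails-total : ∀ {x} → x ≤ N → lsum (map (weight z q) (tails (suc x))) ≈ layerWeight (suc x) (suc N) * F K z q (N ∸ x)
    tails-total {x} x≤N = begin
      lsum (map (weight z q) (map (suc x ∷_) (compsF K N (N ∸ x))))
        ≡⟨ ≡.cong lsum (≡.sym (map-∘ (compsF K N (N ∸ x)))) ⟩
      lsum (map (weight z q ∘ (suc x ∷_)) (compsF K N (N ∸ x)))
        ≡⟨ ≡.cong (lsum ∘ map (weight z q ∘ (suc x ∷_))) (compsF-fuel K (N ∸ x) (ℕₚ.m∸n≤m N x) ℕₚ.≤-refl) ⟩
      lsum (map (weight z q ∘ (suc x ∷_)) (comps K (N ∸ x)))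
        ≈⟨ lsum-congᴬ (compsF-sum K (N ∸ x) (N ∸ x)) (λ {cs} sum≡ → trans (weight-cons (suc x) cs)
             (*-congʳ (reflexive (≡.cong (λ t → layerWeight (suc x) (suc t)) (≡.trans (≡.cong (x +ℕ_) sum≡) (ℕₚ.m+[n∸m]≡n x≤N)))))) ⟩
      lsum (map (λ cs → layerWeight (suc x) (suc N) * weight z q cs) (comps K (N ∸ x)))
        ≈⟨ lsum-*ˡ (layerWeight (suc x) (suc N)) (weight z q) (comps K (N ∸ x)) ⟩
      layerWeight (suc x) (suc N) * F K z q (N ∸ x) ∎

  -- A first layer of length l in a block of size M, after d smaller values are
  -- appended to the block: its weight grows by q^(l d), which together with the
  -- q^((M - l) d) of the rest of the block makes q^(M d) (layer-shift-exponent).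
  layerWeight-shift : ∀ {l M} d → l ≤ M → layerWeight l (M +ℕ d) * pow q ((M ∸ l) *ℕ d) ≈ pow q (M *ℕ d) * layerWeight l M
  layerWeight-shift {l} {M} d l≤M = begin
    z l * pow q a * pow q b   ≈⟨ *-assoc (z l) _ _ ⟩
    z l * (pow q a * pow q b) ≈⟨ *-congˡ (trans (sym (pow-+ a b)) (trans (pow-≡ (layer-shift-exponent ((l ∸ 1) C 2) l M d l≤M)) (pow-+ (M *ℕ d) e))) ⟩
    z l * (pow q (M *ℕ d) * pow q e) ≈⟨ x∙yz≈y∙xz (z l) _ _ ⟩
    pow q (M *ℕ d) * (z l * pow q e) ∎
    where
    open import Algebra.Properties.CommutativeSemigroup *-commutativeSemigroup using (x∙yz≈y∙xz)
    a : ℕ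
    a = (l ∸ 1) C 2 +ℕ l *ℕ (M +ℕ d ∸ l)
    b : ℕ
    b = (M ∸ l) *ℕ d
    e : ℕ
    e = (l ∸ 1) C 2 +ℕ l *ℕ (M ∸ l)

-- Cut a PRLP of size m + n after its m-th entry:
-- either the cut falls between two layers, contributing q^(nm) F m · F n, or it
-- falls inside a layer of length i with j of its entries before the cut.
module Splitting {c ℓ} (R : CommutativeRing c ℓ) (z : ℕ → CommutativeRing.Carrier R) (q : CommutativeRing.Carrier R) (K : ℕ) where
  open Gen R hiding (zero)
  open FiniteSums R
  open FirstLayer R z q
  open import Relation.Binary.Reasoning.Setoid setoid
  open import Relation.Binary.Definitions using (tri<; tri≈; tri>)
  open import Induction.WellFounded using (WfRec)
  open import Data.Nat.Induction using (<-rec)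

  FK : ℕ → Carrier
  FK = F K z q

  -- Sums over the pairs 2 ≤ i ≤ K, 1 ≤ j < i.
  Σ△ : (ℕ → ℕ → Carrier) → Carrier
  Σ△ g = Σ< (K ∸ 1) (λ x → Σ< (suc x) (λ y → g (2 +ℕ x) (suc y)))

  Σ△-cong : ∀ g h → (∀ i y → g i (suc y) ≈ h i (suc y)) → Σ△ g ≈ Σ△ h
  Σ△-cong g h g≈h = Σ-cong (K ∸ 1) (λ x → Σ-cong (suc x) (λ y → g≈h (2 +ℕ x) y))

  Σ△-+ : ∀ g h → Σ△ (λ i j → g i j + h i j) ≈ Σ△ g + Σ△ h
  Σ△-+ g h = trans (Σ-cong (K ∸ 1) (λ x → Σ-+ (suc x) (λ y → g (2 +ℕ x) (suc y)) (λ y → h (2 +ℕ x) (suc y))))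
                   (Σ-+ (K ∸ 1) (λ x → Σ< (suc x) (λ y → g (2 +ℕ x) (suc y))) (λ x → Σ< (suc x) (λ y → h (2 +ℕ x) (suc y))))

  Σ△-Σ : ∀ N (a : ℕ → Carrier) (g : ℕ → ℕ → ℕ → Carrier) →
    Σ△ (λ i j → Σ< N (λ x → a x * g x i j)) ≈ Σ< N (λ x → a x * Σ△ (g x))
  Σ△-Σ N a g = begin
    Σ< (K ∸ 1) (λ w → Σ< (suc w) (λ y → Σ< N (λ x → a x * g x (2 +ℕ w) (suc y))))
      ≈⟨ Σ-cong (K ∸ 1) (λ w → Σ-swap (suc w) N (λ y x → a x * g x (2 +ℕ w) (suc y))) ⟩
    Σ< (K ∸ 1) (λ w → Σ< N (λ x → Σ< (suc w) (λ y → a x * g x (2 +ℕ w) (suc y))))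
      ≈⟨ Σ-swap (K ∸ 1) N (λ w x → Σ< (suc w) (λ y → a x * g x (2 +ℕ w) (suc y))) ⟩
    Σ< N (λ x → Σ< (K ∸ 1) (λ w → Σ< (suc w) (λ y → a x * g x (2 +ℕ w) (suc y))))
      ≈⟨ Σ-cong N (λ x → trans (Σ-cong (K ∸ 1) (λ w → Σ-*ˡ (suc w) (a x) (λ y → g x (2 +ℕ w) (suc y))))
                                     (Σ-*ˡ (K ∸ 1) (a x) (λ w → Σ< (suc w) (λ y → g x (2 +ℕ w) (suc y))))) ⟩
    Σ< N (λ x → a x * Σ△ (g x)) ∎

  -- The PRLPs of size m + n whose cut after position m falls inside a layer
  -- of length i with j entries before the cut: the m - j entries before that
  -- layer form a PRLP, lying above the n + j entries from that layer on.
  straddle : ℕ → ℕ → ℕ → ℕ → Carrier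
  straddle m n i j = if j ≤ᵇ m then pow q ((m ∸ j) *ℕ (n +ℕ j)) * FK (m ∸ j) * firstLayer K (n +ℕ j) i else 0#

  Straddles : ℕ → ℕ → Carrier
  Straddles m n = Σ△ (straddle m n)

  -- The cut falls inside the first layer, of length i.
  cutFirst : ℕ → ℕ → ℕ → ℕ → Carrier
  cutFirst m n i j = if j ≡ᵇ m then firstLayer K (m +ℕ n) i else 0#

  Split : ℕ → ℕ → Set ℓ
  Split m n = FK (m +ℕ n) ≈ pow q (n *ℕ m) * FK m * FK n + Straddles m n

  straddle-empty : ∀ {m n i j} → m < j → straddle m n i j ≈ 0#
  straddle-empty m<j = reflexive (if-≤ᵇ-no m<j)

  Straddles-zero : ∀ n → Straddles 0 n ≈ 0#
  Straddles-zero n = Σ-zero (K ∸ 1) (λ {x} _ → Σ-zero (suc x) (λ {y} _ → straddle-empty {0} {n} {2 +ℕ x} {suc y} z<s))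

  -- Inside a straddle, peel the first layer (of length l) off the PRLP of the
  -- m - j entries before the straddling layer; it becomes the first layer of
  -- the whole PRLP, and what remains is a straddle of the cut after m - l.
  straddle-peel : ∀ m n i l j .{{_ : NonZero l}} .{{_ : NonZero j}} →
    pow q ((m ∸ j) *ℕ (n +ℕ j)) * firstLayer K (m ∸ j) l * firstLayer K (n +ℕ j) i
      ≈ layerWeight l (m +ℕ n) * straddle (m ∸ l) n i j
  straddle-peel m n i l j with l +ℕ j ℕₚ.≤? m
  ... | yes l+j≤m = begin
    pow q ((m ∸ j) *ℕ d) * firstLayer K (m ∸ j) l * L
      ≈⟨ *-congʳ (*-congˡ (firstLayer-fits (ℕₚ.m+n≤o⇒m≤o∸n l l+j≤m))) ⟩
    pow q ((m ∸ j) *ℕ d) * (layerWeight l (m ∸ j) * FK (m ∸ j ∸ l)) * L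
      ≈⟨ *-congʳ (sym (*-assoc _ _ _)) ⟩
    pow q ((m ∸ j) *ℕ d) * layerWeight l (m ∸ j) * FK (m ∸ j ∸ l) * L
      ≈⟨ *-congʳ (*-congʳ (sym (layerWeight-shift d (ℕₚ.m+n≤o⇒m≤o∸n l l+j≤m)))) ⟩
    layerWeight l ((m ∸ j) +ℕ d) * pow q ((m ∸ j ∸ l) *ℕ d) * FK (m ∸ j ∸ l) * L
      ≡⟨ ≡.cong₂ (λ N r → layerWeight l N * pow q (r *ℕ d) * FK r * L) (cut-sizes n j≤m) (∸-swap m j l) ⟩
    layerWeight l (m +ℕ n) * pow q ((m ∸ l ∸ j) *ℕ d) * FK (m ∸ l ∸ j) * L
      ≈⟨ trans (*-congʳ (*-assoc _ _ _)) (*-assoc _ _ _) ⟩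
    layerWeight l (m +ℕ n) * (pow q ((m ∸ l ∸ j) *ℕ d) * FK (m ∸ l ∸ j) * L)
      ≈⟨ *-congˡ (reflexive (≡.sym (if-≤ᵇ-yes j≤m∸l))) ⟩
    layerWeight l (m +ℕ n) * straddle (m ∸ l) n i j ∎
    where
    d : ℕ
    d = n +ℕ j
    L : Carrier
    L = firstLayer K (n +ℕ j) i
    j≤m : j ≤ m
    j≤m = ℕₚ.m+n≤o⇒n≤o l l+j≤m
    j≤m∸l : j ≤ m ∸ l
    j≤m∸l = ℕₚ.m+n≤o⇒m≤o∸n j (≡.subst (_≤ m) (ℕₚ.+-comm l j) l+j≤m)
  ... | no l+j≰m = begin
    pow q ((m ∸ j) *ℕ (n +ℕ j)) * firstLayer K (m ∸ j) l * firstLayer K (n +ℕ j) i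
      ≈⟨ *-congʳ (*-congˡ (firstLayer-too-long (ℕₚ.m<n+o⇒m∸n<o m j (≡.subst (m <_) (ℕₚ.+-comm l j) m<l+j)))) ⟩
    pow q ((m ∸ j) *ℕ (n +ℕ j)) * 0# * firstLayer K (n +ℕ j) i
      ≈⟨ trans (*-congʳ (zeroʳ _)) (zeroˡ _) ⟩
    0#
      ≈⟨ sym (zeroʳ _) ⟩
    layerWeight l (m +ℕ n) * 0#
      ≈⟨ *-congˡ (sym (straddle-empty (ℕₚ.m<n+o⇒m∸n<o m l m<l+j))) ⟩
    layerWeight l (m +ℕ n) * straddle (m ∸ l) n i j ∎
    where
    m<l+j : m < l +ℕ j
    m<l+j = ℕₚ.≰⇒> l+j≰m

  -- Expanding the PRLP before a straddling layer by its first layer.  When the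
  -- straddling layer is itself the first one (j = m), nothing is expanded.
  straddle-rec : ∀ m n i j →
    straddle (suc m) n i (suc j)
      ≈ cutFirst (suc m) n i (suc j) + Σ< K (λ x → layerWeight (suc x) (suc m +ℕ n) * straddle (suc m ∸ suc x) n i (suc j))
  straddle-rec m n i j with ℕₚ.<-cmp j m
  ... | tri< j<m _ _ = begin
    straddle (suc m) n i (suc j)
      ≈⟨ reflexive (if-≤ᵇ-yes (s≤s (ℕₚ.<⇒≤ j<m))) ⟩
    P * FK (m ∸ j) * L
      ≈⟨ *-congʳ (*-congˡ (F-rec K (m ∸ j) (ℕₚ.m<n⇒0<n∸m j<m))) ⟩
    P * Σ< K (λ x → firstLayer K (m ∸ j) (suc x)) * L
      ≈⟨ trans (*-congʳ (sym (Σ-*ˡ K P _))) (sym (Σ-*ʳ K L _)) ⟩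
    Σ< K (λ x → P * firstLayer K (m ∸ j) (suc x) * L)
      ≈⟨ Σ-cong K (λ x → straddle-peel (suc m) n i (suc x) (suc j)) ⟩
    Σ< K (λ x → layerWeight (suc x) (suc m +ℕ n) * straddle (m ∸ x) n i (suc j))
      ≈⟨ +-identityˡ _ ⟨
    0# + Σ< K (λ x → layerWeight (suc x) (suc m +ℕ n) * straddle (m ∸ x) n i (suc j))
      ≈⟨ +-congʳ (reflexive (≡.sym (if-≡ᵇ-no (ℕₚ.<⇒≢ j<m)))) ⟩
    cutFirst (suc m) n i (suc j) + Σ< K (λ x → layerWeight (suc x) (suc m +ℕ n) * straddle (m ∸ x) n i (suc j)) ∎
    where
    P : Carrier
    P = pow q ((m ∸ j) *ℕ (n +ℕ suc j))
    L : Carrier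
    L = firstLayer K (n +ℕ suc j) i
  ... | tri≈ _ ≡.refl _ = begin
    straddle (suc m) n i (suc m)
      ≈⟨ reflexive (if-≤ᵇ-yes (ℕₚ.≤-refl {suc m})) ⟩
    pow q ((m ∸ m) *ℕ (n +ℕ suc m)) * FK (m ∸ m) * firstLayer K (n +ℕ suc m) i
      ≡⟨ ≡.cong₂ (λ e N → pow q (e *ℕ (n +ℕ suc m)) * FK e * firstLayer K N i) (ℕₚ.n∸n≡0 m) (ℕₚ.+-comm n (suc m)) ⟩
    1# * FK 0 * firstLayer K (suc m +ℕ n) i
      ≈⟨ trans (*-congʳ (trans (*-identityˡ _) (F-zero K))) (*-identityˡ _) ⟩
    firstLayer K (suc m +ℕ n) i
      ≈⟨ reflexive (≡.sym (if-≡ᵇ-yes {m = m} ≡.refl)) ⟩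
    cutFirst (suc m) n i (suc m)
      ≈⟨ +-identityʳ _ ⟨
    cutFirst (suc m) n i (suc m) + 0#
      ≈⟨ +-congˡ (sym (peeled-empty (λ x → s≤s (ℕₚ.m∸n≤m m x)))) ⟩
    cutFirst (suc m) n i (suc m) + Σ< K (λ x → layerWeight (suc x) (suc m +ℕ n) * straddle (m ∸ x) n i (suc m)) ∎
    where
    peeled-empty : (∀ x → m ∸ x < suc m) → Σ< K (λ x → layerWeight (suc x) (suc m +ℕ n) * straddle (m ∸ x) n i (suc m)) ≈ 0#
    peeled-empty short = Σ-zero K (λ {x} _ → trans (*-congˡ (straddle-empty (short x))) (zeroʳ _))
  ... | tri> _ _ m<j = begin
    straddle (suc m) n i (suc j)
      ≈⟨ straddle-empty (s≤s m<j) ⟩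
    0#
      ≈⟨ +-identityʳ 0# ⟨
    0# + 0#
      ≈⟨ +-cong (reflexive (≡.sym (if-≡ᵇ-no (ℕₚ.>⇒≢ m<j))))
                (sym (Σ-zero K (λ {x} _ → trans (*-congˡ (straddle-empty (ℕₚ.m<n⇒m<1+n (ℕₚ.≤-<-trans (ℕₚ.m∸n≤m m x) m<j)))) (zeroʳ _)))) ⟩
    cutFirst (suc m) n i (suc j) + Σ< K (λ x → layerWeight (suc x) (suc m +ℕ n) * straddle (m ∸ x) n i (suc j)) ∎

  -- The first layer has length l > m, so it contains the cut.
  longFirst : ℕ → ℕ → ℕ → Carrier
  longFirst m n l = if m <ᵇ l then firstLayer K (m +ℕ n) l else 0#

  cutFirst-total : ∀ m n → Σ△ (cutFirst (suc m) n) ≈ Σ< K (λ x → longFirst (suc m) n (suc x))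
  cutFirst-total m n = count K
    where
    count : ∀ N → Σ< (N ∸ 1) (λ x → Σ< (suc x) (λ y → cutFirst (suc m) n (2 +ℕ x) (suc y)))
                  ≈ Σ< N (λ x → longFirst (suc m) n (suc x))
    count zero    = refl
    count (suc N) = trans (Σ-cong N (λ x → Σ-delta (suc x) m (firstLayer K (suc m +ℕ n) (2 +ℕ x)))) (sym (+-identityˡ _))

  -- The straddle terms for a cut after m + 1 entries: the cut lies in the first
  -- layer, or the first layer (of length x + 1) ends before the cut.
  Straddles-rec : ∀ m n →
    Straddles (suc m) n ≈ Σ< K (λ x → layerWeight (suc x) (suc m +ℕ n) * Straddles (suc m ∸ suc x) n)
                          + Σ< K (λ x → longFirst (suc m) n (suc x))
  Straddles-rec m n = begin
    Σ△ (straddle (suc m) n)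
      ≈⟨ Σ△-cong (straddle (suc m) n) (λ i j → cutFirst (suc m) n i j + Σ< K (λ x → a x * straddle (suc m ∸ suc x) n i j))
                 (straddle-rec m n) ⟩
    Σ△ (λ i j → cutFirst (suc m) n i j + Σ< K (λ x → a x * straddle (suc m ∸ suc x) n i j))
      ≈⟨ Σ△-+ (cutFirst (suc m) n) (λ i j → Σ< K (λ x → a x * straddle (suc m ∸ suc x) n i j)) ⟩
    Σ△ (cutFirst (suc m) n) + Σ△ (λ i j → Σ< K (λ x → a x * straddle (suc m ∸ suc x) n i j))
      ≈⟨ +-cong (cutFirst-total m n) (Σ△-Σ K a (λ x → straddle (suc m ∸ suc x) n)) ⟩
    Σ< K (λ x → longFirst (suc m) n (suc x)) + Σ< K (λ x → a x * Straddles (suc m ∸ suc x) n)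
      ≈⟨ +-comm _ _ ⟩
    Σ< K (λ x → a x * Straddles (suc m ∸ suc x) n) + Σ< K (λ x → longFirst (suc m) n (suc x)) ∎
    where
    a : ℕ → Carrier
    a x = layerWeight (suc x) (suc m +ℕ n)

  -- The first layer (of length l) of a PRLP of size m + n either ends before
  -- the cut, and the rest is split by the splitting identity for m - l and n,
  -- or it contains the cut.
  split-firstLayer : ∀ m n l .{{_ : NonZero l}} → (l ≤ m → Split (m ∸ l) n) →
    firstLayer K (m +ℕ n) l
      ≈ pow q (n *ℕ m) * firstLayer K m l * FK n + (layerWeight l (m +ℕ n) * Straddles (m ∸ l) n + longFirst m n l)
  split-firstLayer m n l split with l ℕₚ.≤? m
  ... | yes l≤m = begin
    firstLayer K (m +ℕ n) l
      ≈⟨ firstLayer-fits (ℕₚ.≤-trans l≤m (ℕₚ.m≤m+n m n)) ⟩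
    a * FK (m +ℕ n ∸ l)
      ≡⟨ ≡.cong (λ N → a * FK N) (ℕₚ.+-∸-comm n l≤m) ⟩
    a * FK ((m ∸ l) +ℕ n)
      ≈⟨ *-congˡ (split l≤m) ⟩
    a * (pow q (n *ℕ (m ∸ l)) * FK (m ∸ l) * FK n + Straddles (m ∸ l) n)
      ≈⟨ distribˡ a _ _ ⟩
    a * (pow q (n *ℕ (m ∸ l)) * FK (m ∸ l) * FK n) + a * Straddles (m ∸ l) n
      ≈⟨ +-cong before-cut (sym (+-identityʳ _)) ⟩
    pow q (n *ℕ m) * firstLayer K m l * FK n + (a * Straddles (m ∸ l) n + 0#)
      ≈⟨ +-congˡ (+-congˡ (reflexive (≡.sym (if-≤ᵇ-no {m = suc m} (s≤s l≤m))))) ⟩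
    pow q (n *ℕ m) * firstLayer K m l * FK n + (a * Straddles (m ∸ l) n + longFirst m n l) ∎
    where
    a : Carrier
    a = layerWeight l (m +ℕ n)
    shifted : a * pow q (n *ℕ (m ∸ l)) ≈ pow q (n *ℕ m) * layerWeight l m
    shifted = trans (*-congˡ (pow-≡ (ℕₚ.*-comm n (m ∸ l))))
                    (trans (layerWeight-shift n l≤m) (*-congʳ (pow-≡ (ℕₚ.*-comm m n))))
    before-cut : a * (pow q (n *ℕ (m ∸ l)) * FK (m ∸ l) * FK n) ≈ pow q (n *ℕ m) * firstLayer K m l * FK n
    before-cut = begin
      a * (pow q (n *ℕ (m ∸ l)) * FK (m ∸ l) * FK n)   ≈⟨ trans (sym (*-assoc _ _ _)) (*-congʳ (sym (*-assoc _ _ _))) ⟩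
      a * pow q (n *ℕ (m ∸ l)) * FK (m ∸ l) * FK n     ≈⟨ *-congʳ (*-congʳ shifted) ⟩
      pow q (n *ℕ m) * layerWeight l m * FK (m ∸ l) * FK n ≈⟨ *-congʳ (*-assoc _ _ _) ⟩
      pow q (n *ℕ m) * (layerWeight l m * FK (m ∸ l)) * FK n ≈⟨ *-congʳ (*-congˡ (sym (firstLayer-fits l≤m))) ⟩
      pow q (n *ℕ m) * firstLayer K m l * FK n         ∎
  ... | no l≰m = begin
    firstLayer K (m +ℕ n) l
      ≈⟨ reflexive (≡.sym (if-≤ᵇ-yes {m = suc m} m<l)) ⟩
    longFirst m n l
      ≈⟨ trans (sym (+-identityˡ _)) (sym (+-identityˡ _)) ⟩
    0# + (0# + longFirst m n l)
      ≈⟨ +-cong (sym before-nothing) (+-congʳ (sym (trans (*-congˡ no-straddles) (zeroʳ _)))) ⟩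
    pow q (n *ℕ m) * firstLayer K m l * FK n + (layerWeight l (m +ℕ n) * Straddles (m ∸ l) n + longFirst m n l) ∎
    where
    m<l : m < l
    m<l = ℕₚ.≰⇒> l≰m
    before-nothing : pow q (n *ℕ m) * firstLayer K m l * FK n ≈ 0#
    before-nothing = trans (*-congʳ (trans (*-congˡ (firstLayer-too-long m<l)) (zeroʳ _))) (zeroˡ _)
    no-straddles : Straddles (m ∸ l) n ≈ 0#
    no-straddles = trans (reflexive (≡.cong (λ r → Straddles r n) (ℕₚ.m≤n⇒m∸n≡0 (ℕₚ.<⇒≤ m<l)))) (Straddles-zero n)

  split-zero : ∀ n → Split 0 n
  split-zero n = sym (begin
    pow q (n *ℕ 0) * FK 0 * FK n + Straddles 0 n
      ≈⟨ +-cong (*-congʳ (*-cong (pow-≡ (ℕₚ.*-zeroʳ n)) (F-zero K))) (Straddles-zero n) ⟩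
    1# * 1# * FK n + 0#
      ≈⟨ +-identityʳ _ ⟩
    1# * 1# * FK n
      ≈⟨ trans (*-congʳ (*-identityˡ 1#)) (*-identityˡ _) ⟩
    FK n ∎)

  -- Expand F (m + n) by its first layer and sort the three kinds of terms.
  split-suc : ∀ m n → (∀ {r} → r < suc m → Split r n) → Split (suc m) n
  split-suc m n split = begin
    FK (suc m +ℕ n)
      ≈⟨ F-rec K (suc m +ℕ n) (s≤s z≤n) ⟩
    Σ< K (λ x → firstLayer K (suc m +ℕ n) (suc x))
      ≈⟨ Σ-cong K (λ x → split-firstLayer (suc m) n (suc x) (λ _ → split (s≤s (ℕₚ.m∸n≤m m x)))) ⟩
    Σ< K (λ x → before x + (across x + long x))
      ≈⟨ trans (Σ-+ K before _) (+-congˡ (Σ-+ K across long)) ⟩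
    Σ< K before + (Σ< K across + Σ< K long)
      ≈⟨ +-cong all-before (sym (Straddles-rec m n)) ⟩
    pow q (n *ℕ suc m) * FK (suc m) * FK n + Straddles (suc m) n ∎
    where
    before across long : ℕ → Carrier
    before x = pow q (n *ℕ suc m) * firstLayer K (suc m) (suc x) * FK n
    across x = layerWeight (suc x) (suc m +ℕ n) * Straddles (suc m ∸ suc x) n
    long   x = longFirst (suc m) n (suc x)
    all-before : Σ< K before ≈ pow q (n *ℕ suc m) * FK (suc m) * FK n
    all-before = begin
      Σ< K before
        ≈⟨ Σ-*ʳ K (FK n) (λ x → pow q (n *ℕ suc m) * firstLayer K (suc m) (suc x)) ⟩
      Σ< K (λ x → pow q (n *ℕ suc m) * firstLayer K (suc m) (suc x)) * FK n
        ≈⟨ *-congʳ (Σ-*ˡ K (pow q (n *ℕ suc m)) (λ x → firstLayer K (suc m) (suc x))) ⟩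
      pow q (n *ℕ suc m) * Σ< K (λ x → firstLayer K (suc m) (suc x)) * FK n
        ≈⟨ *-congʳ (*-congˡ (sym (F-rec K (suc m) (s≤s z≤n)))) ⟩
      pow q (n *ℕ suc m) * FK (suc m) * FK n ∎

  split : ∀ m n → Split m n
  split m n = <-rec (λ r → Split r n) step m
    where
    step : ∀ r → WfRec _<_ (λ r → Split r n) r → Split r n
    step zero    _     = split-zero n
    step (suc r) split = split-suc r n split

  straddleTerm : ℕ → ℕ → ℕ → ℕ → Carrier
  straddleTerm m n i j =
    if (j ≤ᵇ m) ∧ (i ≤ᵇ n +ℕ j)
    then z i * pow q (((i ∸ 1) C 2) +ℕ i *ℕ (n +ℕ j ∸ i)) * pow q ((m ∸ j) *ℕ (n +ℕ j)) * FK (m ∸ j) * FK (n +ℕ j ∸ i)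
    else 0#

  straddleBody : ℕ → ℕ → ℕ → ℕ → Carrier
  straddleBody m n i j = layerWeight i (n +ℕ j) * pow q ((m ∸ j) *ℕ (n +ℕ j)) * FK (m ∸ j) * FK (n +ℕ j ∸ i)

  straddle-explicit : ∀ m n i j → straddle m n i j ≈ straddleTerm m n i j
  straddle-explicit m n i j with j ℕₚ.≤? m
  ... | no j≰m = trans (straddle-empty (ℕₚ.≰⇒> j≰m))
                       (reflexive (≡.cong (λ b → if b ∧ (i ≤ᵇ n +ℕ j) then straddleBody m n i j else 0#)
                                          (≡.sym (≤ᵇ-false (ℕₚ.≰⇒> j≰m)))))
  ... | yes j≤m = begin
    straddle m n i j
      ≈⟨ reflexive (if-≤ᵇ-yes j≤m) ⟩
    P * FK (m ∸ j) * firstLayer K (n +ℕ j) i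
      ≈⟨ layer-fits-or-not ⟩
    (if i ≤ᵇ n +ℕ j then straddleBody m n i j else 0#)
      ≡⟨ ≡.cong (λ b → if b ∧ (i ≤ᵇ n +ℕ j) then straddleBody m n i j else 0#) (≡.sym (≤ᵇ-true j≤m)) ⟩
    straddleTerm m n i j ∎
    where
    P : Carrier
    P = pow q ((m ∸ j) *ℕ (n +ℕ j))
    layer-fits-or-not : P * FK (m ∸ j) * firstLayer K (n +ℕ j) i ≈ (if i ≤ᵇ n +ℕ j then straddleBody m n i j else 0#)
    layer-fits-or-not with i ℕₚ.≤? n +ℕ j
    ... | yes i≤ = begin
      P * FK (m ∸ j) * firstLayer K (n +ℕ j) i                     ≈⟨ *-congˡ (firstLayer-fits i≤) ⟩
      P * FK (m ∸ j) * (layerWeight i (n +ℕ j) * FK (n +ℕ j ∸ i))  ≈⟨ bring-forward _ _ _ _ ⟩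
      straddleBody m n i j                                         ≈⟨ reflexive (≡.sym (if-≤ᵇ-yes i≤)) ⟩
      (if i ≤ᵇ n +ℕ j then straddleBody m n i j else 0#)           ∎
    ... | no i≰ = trans (*-congˡ (firstLayer-too-long (ℕₚ.≰⇒> i≰)))
                        (trans (zeroʳ _) (reflexive (≡.sym (if-≤ᵇ-no (ℕₚ.≰⇒> i≰)))))

  Straddles-explicit : ∀ m n → Straddles m n ≈ sumFromTo 2 K (λ i → sumFromTo 1 (i ∸ 1) (straddleTerm m n i))
  Straddles-explicit m n = begin
    Σ△ (straddle m n)
      ≈⟨ Σ△-cong (straddle m n) (straddleTerm m n) (λ i y → straddle-explicit m n i (suc y)) ⟩
    Σ< (K ∸ 1) (λ x → Σ< (suc x) (λ y → straddleTerm m n (2 +ℕ x) (suc y)))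
      ≈⟨ Σ-cong (K ∸ 1) (λ x → reflexive (≡.sym (lsum-applyUpTo (straddleTerm m n (2 +ℕ x)) suc (suc x)))) ⟩
    Σ< (K ∸ 1) (λ x → sumFromTo 1 (suc x) (straddleTerm m n (2 +ℕ x)))
      ≡⟨ ≡.sym (lsum-applyUpTo (λ i → sumFromTo 1 (i ∸ 1) (straddleTerm m n i)) (2 +ℕ_) (K ∸ 1)) ⟩
    sumFromTo 2 K (λ i → sumFromTo 1 (i ∸ 1) (straddleTerm m n i)) ∎

-- A PRLP with layers of length at most K = K′ + 1
-- either has all layers shorter than K, or its first layer of length K comes
-- after j entries, which form a PRLP with layers shorter than K.
module MaximalLayer {c ℓ} (R : CommutativeRing c ℓ) (z : ℕ → CommutativeRing.Carrier R) (q : CommutativeRing.Carrier R) (K′ : ℕ) where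
  open Gen R hiding (zero)
  open FiniteSums R
  open FirstLayer R z q
  open import Relation.Binary.Reasoning.Setoid setoid
  open import Induction.WellFounded using (WfRec)
  open import Data.Nat.Induction using (<-rec)

  K : ℕ
  K = suc K′

  FK F′ : ℕ → Carrier
  FK = F K z q
  F′ = F K′ z q

  -- The PRLPs of size n whose first layer of length K comes after j entries.
  afterShorter : ℕ → ℕ → Carrier
  afterShorter n j = pow q (j *ℕ (n ∸ j)) * F′ j * firstLayer K (n ∸ j) K

  LongLayers : ℕ → Carrier
  LongLayers n = Σ< (suc n) (afterShorter n)

  Max : ℕ → Set ℓ
  Max n = FK n ≈ F′ n + LongLayers n

  afterShorter-zero : ∀ n → afterShorter n 0 ≈ firstLayer K n K
  afterShorter-zero n = trans (*-congʳ (trans (*-identityˡ _) (F-zero K′))) (*-identityˡ _)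

  max-zero : Max 0
  max-zero = begin
    FK 0                                ≈⟨ F-zero K ⟩
    1#                                  ≈⟨ +-identityʳ 1# ⟨
    1# + 0#                             ≈⟨ +-cong (sym (F-zero K′)) (sym (trans (+-identityʳ _) (trans (afterShorter-zero 0) (firstLayer-too-long {K} {0} {K} z<s)))) ⟩
    F′ 0 + LongLayers 0                 ∎

  -- A first layer of length l < K followed by a PRLP containing a layer of length K.
  shorterFirst : ℕ → ℕ → Carrier
  shorterFirst n l = if l ≤ᵇ n then layerWeight l n * LongLayers (n ∸ l) else 0#

  -- Split the PRLPs after a first layer of length l by the identity for n - l.
  firstLayer-split : ∀ n l .{{_ : NonZero l}} → (l ≤ n → Max (n ∸ l)) →
    firstLayer K n l ≈ firstLayer K′ n l + shorterFirst n l
  firstLayer-split n l max with l ℕₚ.≤? n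
  ... | yes l≤n = begin
    firstLayer K n l                                                 ≈⟨ firstLayer-fits l≤n ⟩
    layerWeight l n * FK (n ∸ l)                                     ≈⟨ *-congˡ (max l≤n) ⟩
    layerWeight l n * (F′ (n ∸ l) + LongLayers (n ∸ l))              ≈⟨ distribˡ _ _ _ ⟩
    layerWeight l n * F′ (n ∸ l) + layerWeight l n * LongLayers (n ∸ l)
      ≈⟨ +-cong (sym (firstLayer-fits l≤n)) (reflexive (≡.sym (if-≤ᵇ-yes l≤n))) ⟩
    firstLayer K′ n l + shorterFirst n l                             ∎
  ... | no l≰n = begin
    firstLayer K n l                     ≈⟨ firstLayer-too-long (ℕₚ.≰⇒> l≰n) ⟩
    0#                                   ≈⟨ +-identityʳ 0# ⟨
    0# + 0#                              ≈⟨ +-cong (sym (firstLayer-too-long (ℕₚ.≰⇒> l≰n))) (reflexive (≡.sym (if-≤ᵇ-no (ℕₚ.≰⇒> l≰n)))) ⟩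
    firstLayer K′ n l + shorterFirst n l ∎

  -- PRLPs of size n with first layer of length x + 1 < K and with their first
  -- layer of length K after the first y + 1 entries.
  firstBeforeLong : ℕ → ℕ → ℕ → Carrier
  firstBeforeLong n x y = pow q (suc y *ℕ (n ∸ suc y)) * firstLayer K′ (suc y) (suc x) * firstLayer K (n ∸ suc y) K

  -- Setting the first layer aside leaves a PRLP of size n - (x + 1) whose
  -- first layer of length K comes after y - x entries.
  firstBeforeLong-peel : ∀ n x y → y < n →
    firstBeforeLong n x y ≈ (if x ≤ᵇ y then layerWeight (suc x) n * afterShorter (n ∸ suc x) (y ∸ x) else 0#)
  firstBeforeLong-peel n x y y<n with x ℕₚ.≤? y
  ... | yes x≤y = begin
    P * firstLayer K′ (suc y) (suc x) * L
      ≈⟨ *-congʳ (*-congˡ (firstLayer-fits (s≤s x≤y))) ⟩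
    P * (layerWeight (suc x) (suc y) * F′ (y ∸ x)) * L
      ≈⟨ *-congʳ (sym (*-assoc _ _ _)) ⟩
    P * layerWeight (suc x) (suc y) * F′ (y ∸ x) * L
      ≈⟨ *-congʳ (*-congʳ (sym (layerWeight-shift (n ∸ suc y) (s≤s x≤y)))) ⟩
    layerWeight (suc x) (suc y +ℕ (n ∸ suc y)) * pow q ((y ∸ x) *ℕ (n ∸ suc y)) * F′ (y ∸ x) * L
      ≡⟨ ≡.cong₂ (λ N r → layerWeight (suc x) N * pow q ((y ∸ x) *ℕ r) * F′ (y ∸ x) * firstLayer K r K)
                 (ℕₚ.m+[n∸m]≡n y<n) (≡.sym (∸-in-two-steps n x≤y)) ⟩
    layerWeight (suc x) n * pow q ((y ∸ x) *ℕ (n ∸ suc x ∸ (y ∸ x))) * F′ (y ∸ x) * firstLayer K (n ∸ suc x ∸ (y ∸ x)) K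
      ≈⟨ trans (*-congʳ (*-assoc _ _ _)) (*-assoc _ _ _) ⟩
    layerWeight (suc x) n * afterShorter (n ∸ suc x) (y ∸ x)
      ≈⟨ reflexive (≡.sym (if-≤ᵇ-yes x≤y)) ⟩
    (if x ≤ᵇ y then layerWeight (suc x) n * afterShorter (n ∸ suc x) (y ∸ x) else 0#) ∎
    where
    P : Carrier
    P = pow q (suc y *ℕ (n ∸ suc y))
    L : Carrier
    L = firstLayer K (n ∸ suc y) K
  ... | no x≰y = begin
    firstBeforeLong n x y
      ≈⟨ trans (*-congʳ (trans (*-congˡ (firstLayer-too-long (s≤s (ℕₚ.≰⇒> x≰y)))) (zeroʳ _))) (zeroˡ _) ⟩
    0#
      ≈⟨ reflexive (≡.sym (if-≤ᵇ-no (ℕₚ.≰⇒> x≰y))) ⟩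
    (if x ≤ᵇ y then layerWeight (suc x) n * afterShorter (n ∸ suc x) (y ∸ x) else 0#) ∎

  shorterFirst-total : ∀ n x → Σ< n (firstBeforeLong n x) ≈ shorterFirst n (suc x)
  shorterFirst-total n x = begin
    Σ< n (firstBeforeLong n x)
      ≈⟨ Σ-congᴮ n (firstBeforeLong-peel n x _) ⟩
    Σ< n (λ y → if x ≤ᵇ y then a * afterShorter (n ∸ suc x) (y ∸ x) else 0#)
      ≈⟨ Σ-shift x n (λ y → a * afterShorter (n ∸ suc x) (y ∸ x)) ⟩
    Σ< (n ∸ x) (λ j → a * afterShorter (n ∸ suc x) (x +ℕ j ∸ x))
      ≈⟨ Σ-cong (n ∸ x) (λ j → *-congˡ (reflexive (≡.cong (afterShorter (n ∸ suc x)) (ℕₚ.m+n∸m≡n x j)))) ⟩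
    Σ< (n ∸ x) (λ j → a * afterShorter (n ∸ suc x) j)
      ≈⟨ Σ-*ˡ (n ∸ x) a (afterShorter (n ∸ suc x)) ⟩
    a * Σ< (n ∸ x) (afterShorter (n ∸ suc x))
      ≈⟨ fits-or-not ⟩
    shorterFirst n (suc x) ∎
    where
    a : Carrier
    a = layerWeight (suc x) n
    fits-or-not : a * Σ< (n ∸ x) (afterShorter (n ∸ suc x)) ≈ shorterFirst n (suc x)
    fits-or-not with suc x ℕₚ.≤? n
    ... | yes x<n = trans (reflexive (≡.cong (λ N → a * Σ< N (afterShorter (n ∸ suc x))) (∸-pred x<n)))
                          (reflexive (≡.sym (if-≤ᵇ-yes x<n)))
    ... | no x≮n  = trans (*-congˡ (reflexive (≡.cong (λ N → Σ< N (afterShorter (n ∸ suc x)))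
                                                      (ℕₚ.m≤n⇒m∸n≡0 (s≤s⁻¹ (ℕₚ.≰⇒> x≮n))))))
                          (trans (zeroʳ a) (reflexive (≡.sym (if-≤ᵇ-no (ℕₚ.≰⇒> x≮n)))))

  -- Expanding the shorter-layer PRLP before the layer of length K by its first layer.
  LongLayers-rec : ∀ n → Σ< n (λ y → afterShorter n (suc y)) ≈ Σ< K′ (λ x → shorterFirst n (suc x))
  LongLayers-rec n = begin
    Σ< n (λ y → afterShorter n (suc y))
      ≈⟨ Σ-cong n expand ⟩
    Σ< n (λ y → Σ< K′ (λ x → firstBeforeLong n x y))
      ≈⟨ Σ-swap n K′ (λ y x → firstBeforeLong n x y) ⟩
    Σ< K′ (λ x → Σ< n (firstBeforeLong n x))
      ≈⟨ Σ-cong K′ (shorterFirst-total n) ⟩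
    Σ< K′ (λ x → shorterFirst n (suc x)) ∎
    where
    expand : ∀ y → afterShorter n (suc y) ≈ Σ< K′ (λ x → firstBeforeLong n x y)
    expand y = begin
      P * F′ (suc y) * L                                ≈⟨ *-congʳ (*-congˡ (F-rec K′ (suc y) (s≤s z≤n))) ⟩
      P * Σ< K′ (λ x → firstLayer K′ (suc y) (suc x)) * L
        ≈⟨ *-congʳ (sym (Σ-*ˡ K′ P (λ x → firstLayer K′ (suc y) (suc x)))) ⟩
      Σ< K′ (λ x → P * firstLayer K′ (suc y) (suc x)) * L
        ≈⟨ sym (Σ-*ʳ K′ L (λ x → P * firstLayer K′ (suc y) (suc x))) ⟩
      Σ< K′ (λ x → firstBeforeLong n x y)               ∎
      where
      P : Carrier
      P = pow q (suc y *ℕ (n ∸ suc y))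
      L : Carrier
      L = firstLayer K (n ∸ suc y) K

  -- Expand F (n + 1) by its first layer, of length < K or = K.
  max-suc : ∀ n → (∀ {r} → r < suc n → Max r) → Max (suc n)
  max-suc n max = begin
    FK (suc n)
      ≈⟨ F-rec K (suc n) (s≤s z≤n) ⟩
    Σ< K (λ x → firstLayer K (suc n) (suc x))
      ≈⟨ Σ-last K′ (λ x → firstLayer K (suc n) (suc x)) ⟩
    Σ< K′ (λ x → firstLayer K (suc n) (suc x)) + firstLayer K (suc n) K
      ≈⟨ +-congʳ (Σ-cong K′ (λ x → firstLayer-split (suc n) (suc x) (λ _ → max (s≤s (ℕₚ.m∸n≤m n x))))) ⟩
    Σ< K′ (λ x → firstLayer K′ (suc n) (suc x) + shorterFirst (suc n) (suc x)) + firstLayer K (suc n) K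
      ≈⟨ +-congʳ (Σ-+ K′ (λ x → firstLayer K′ (suc n) (suc x)) (λ x → shorterFirst (suc n) (suc x))) ⟩
    Σ< K′ (λ x → firstLayer K′ (suc n) (suc x)) + Σ< K′ (λ x → shorterFirst (suc n) (suc x)) + firstLayer K (suc n) K
      ≈⟨ +-congʳ (+-cong (sym (F-rec K′ (suc n) (s≤s z≤n))) (sym (LongLayers-rec (suc n)))) ⟩
    F′ (suc n) + Σ< (suc n) (λ y → afterShorter (suc n) (suc y)) + firstLayer K (suc n) K
      ≈⟨ +-assoc _ _ _ ⟩
    F′ (suc n) + (Σ< (suc n) (λ y → afterShorter (suc n) (suc y)) + firstLayer K (suc n) K)
      ≈⟨ +-congˡ (trans (+-comm _ _) (+-congʳ (sym (afterShorter-zero (suc n))))) ⟩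
    F′ (suc n) + LongLayers (suc n) ∎

  max : ∀ n → Max n
  max = <-rec Max step
    where
    step : ∀ n → WfRec _<_ Max n → Max n
    step zero    _   = max-zero
    step (suc n) max = max-suc n max

  longTerm : ℕ → ℕ → Carrier
  longTerm n j =
    if K ≤ᵇ n
    then z K * pow q (((K ∸ 1) C 2) +ℕ K *ℕ (n ∸ K ∸ j)) * pow q (j *ℕ (n ∸ j)) * F (K ∸ 1) z q j * F K z q (n ∸ K ∸ j)
    else 0#

  afterShorter-explicit : ∀ n j → j ≤ n ∸ K → afterShorter n j ≈ longTerm n j
  afterShorter-explicit n j j≤n∸K with K ℕₚ.≤? n
  ... | yes K≤n = begin
    P * F′ j * firstLayer K (n ∸ j) K
      ≈⟨ *-congˡ (firstLayer-fits K≤n∸j) ⟩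
    P * F′ j * (layerWeight K (n ∸ j) * FK (n ∸ j ∸ K))
      ≈⟨ bring-forward _ _ _ _ ⟩
    layerWeight K (n ∸ j) * P * F′ j * FK (n ∸ j ∸ K)
      ≡⟨ ≡.cong (λ r → z K * pow q ((K ∸ 1) C 2 +ℕ K *ℕ r) * P * F′ j * FK r) (∸-swap n j K) ⟩
    z K * pow q ((K ∸ 1) C 2 +ℕ K *ℕ (n ∸ K ∸ j)) * P * F′ j * FK (n ∸ K ∸ j)
      ≈⟨ reflexive (≡.sym (if-≤ᵇ-yes K≤n)) ⟩
    longTerm n j ∎
    where
    P : Carrier
    P = pow q (j *ℕ (n ∸ j))
    K≤n∸j : K ≤ n ∸ j
    K≤n∸j = ℕₚ.m+n≤o⇒m≤o∸n K (≡.subst (_≤ n) (ℕₚ.+-comm j K) (ℕₚ.m≤o∸n⇒m+n≤o j K≤n j≤n∸K))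
  ... | no K≰n = begin
    afterShorter n j
      ≈⟨ *-congˡ (firstLayer-too-long (ℕₚ.≤-<-trans (ℕₚ.m∸n≤m n j) (ℕₚ.≰⇒> K≰n))) ⟩
    pow q (j *ℕ (n ∸ j)) * F′ j * 0#
      ≈⟨ zeroʳ _ ⟩
    0#
      ≈⟨ reflexive (≡.sym (if-≤ᵇ-no (ℕₚ.≰⇒> K≰n))) ⟩
    longTerm n j ∎

  afterShorter-beyond : ∀ n j → n ∸ K < j → afterShorter n j ≈ 0#
  afterShorter-beyond n j n∸K<j = trans (*-congˡ (firstLayer-too-long n∸j<K)) (zeroʳ _)
    where
    n∸j<K : n ∸ j < K
    n∸j<K = ℕₚ.m<n+o⇒m∸n<o n j (≡.subst (n <_) (ℕₚ.+-comm K j) (ℕₚ.≤-<-trans (ℕₚ.m≤n+m∸n n K) (ℕₚ.+-monoʳ-< K n∸K<j)))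

  LongLayers-explicit : ∀ n → LongLayers n ≈ sumFromTo 0 (n ∸ K) (longTerm n)
  LongLayers-explicit n = begin
    Σ< (suc n) (afterShorter n)
      ≈⟨ Σ-prefix (s≤s (ℕₚ.m∸n≤m n K)) (λ {j} n∸K<j _ → afterShorter-beyond n j n∸K<j) ⟩
    Σ< (suc (n ∸ K)) (afterShorter n)
      ≈⟨ Σ-congᴮ (suc (n ∸ K)) (λ {j} j<1+n∸K → afterShorter-explicit n j (s≤s⁻¹ j<1+n∸K)) ⟩
    Σ< (suc (n ∸ K)) (longTerm n)
      ≡⟨ ≡.sym (lsum-applyUpTo (longTerm n) (0 +ℕ_) (suc (n ∸ K))) ⟩
    sumFromTo 0 (n ∸ K) (longTerm n) ∎

-- Both identities hold for all m, n ≥ 0; the theorem states them for m, n ≥ 1.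
mainTheorem11 : ∀ {c ℓ : Level} (R : CommutativeRing c ℓ) → let open Gen R in
    (k : ℕ) → 1 ≤ k → (z : ℕ → Carrier) (q : Carrier) →
      ((m n : ℕ) → 1 ≤ m → 1 ≤ n →
        F k z q (m +ℕ n) ≈
          pow q (n *ℕ m) * F k z q m * F k z q n
          + sumFromTo 2 k (λ i → sumFromTo 1 (i ∸ 1) (λ j →
              if (j ≤ᵇ m) ∧ (i ≤ᵇ n +ℕ j)
              then z i * pow q (((i ∸ 1) C 2) +ℕ i *ℕ (n +ℕ j ∸ i))
                       * pow q ((m ∸ j) *ℕ (n +ℕ j))
                       * F k z q (m ∸ j) * F k z q (n +ℕ j ∸ i)
              else 0#)))
      ×
      ((n : ℕ) → 1 ≤ n →
        F k z q n ≈
          F (k ∸ 1) z q n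
          + sumFromTo 0 (n ∸ k) (λ j →
              if k ≤ᵇ n
              then z k * pow q (((k ∸ 1) C 2) +ℕ k *ℕ (n ∸ k ∸ j))
                       * pow q (j *ℕ (n ∸ j))
                       * F (k ∸ 1) z q j * F k z q (n ∸ k ∸ j)
              else 0#))
mainTheorem11 R (suc K′) (s≤s z≤n) z q =
  (λ m n _ _ → trans (split m n) (+-congˡ (Straddles-explicit m n))) ,
  (λ n _ → trans (max n) (+-congˡ (LongLayers-explicit n)))
  where
  open Gen R hiding (zero)
  open Splitting R z q (suc K′) using (split; Straddles-explicit)
  open MaximalLayer R z q K′ using (max; LongLayers-explicit)
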